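{- Let $n\ge1$. Then $H(\mathbb{Q})_+\cap H(\widehat{\mathbb{Z}}^p)U(p^n)^\lozenge\subset U(p^n)$ (meaning: every element of $H(\mathbb{Q})_+$ whose image in $H(\mathbb{A}_f)$ lies in $H(\widehat{\mathbb{Z}}^p)U(p^n)^\lozenge$ has image in $H(\mathbb{Q}_p)$ lying in $U(p^n)$). In particular, if $K^p_H\subset H(\widehat{\mathbb{Z}}^p)$ is a compact open subgroup and $x\in H(\mathbb{A}_f)$ has $p$-component $1$ and prime-to-$p$ component in $H(\widehat{\mathbb{Z}}^p)$, then $H(\mathbb{Q})_+\cap xK^p_HU(p^n)^\lozenge x^{ -1}\subset U(p^n)$.
   Context: Let $p$ be a prime and $H=\mathrm{GL}_2\times\mathrm{GL}_1$. $H(\mathbb{Q})_+$ denotes the set of $(h_1,h_2)\in H(\mathbb{Q})$ whose image in $H(\mathbb{R})$ lies in the identity component, i.e. $\det h_1>0$ and $h_2>0$. $H(\widehat{\mathbb{Z}}^p)=\prod_{\ell\ne p}H(\mathbb{Z}_\ell)$, viewed in $H(\mathbb{A}_f)$ with trivial $p$-component. For $n\ge1$: $U(p^n)\subset H(\mathbb{Z}_p)$ is the subgroup of $(h_1,h_2)$ with $h_1\equiv I_2$ and $h_2\equiv 1 \pmod{p^n}$; $U(p^n)^\lozenge\subset H(\mathbb{Z}_p)$ is the subgroup of $(h_1,h_2)$ with $h_1\equiv\left(\begin{smallmatrix}*&0\\0&1\end{smallmatrix}\right)\pmod{p^n}$ (and $h_2\in\mathbb{Z}_p^\times$ arbitrary).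 -}

module Defs where

open import Data.Nat using (ℕ; _^_)
open import Data.Nat.Divisibility using (_∣_)
open import Data.Integer using (+_)
open import Data.Rational using (ℚ; _*_; _-_; _/_; 0ℚ; 1ℚ; _<_; ↧ₙ_)
open import Data.Product using (_×_; Σ)
open import Relation.Binary.PropositionalEquality using (_≡_)
open import Relation.Nullary using (¬_)

record Mat2 : Set where
  constructor mat
  field
    a b c d : ℚ
open Mat2 public

det : Mat2 → ℚ
det m = a m * d m - b m * c m

-- H(ℚ) = GL₂(ℚ) × GL₁(ℚ); an element is a pair (h₁ , h₂).
H-ℚ : Set
H-ℚ = Mat2 × ℚ

-- H(ℚ)₊ : det h₁ > 0 and h₂ > 0 (this also implies h ∈ H(ℚ)).
InHℚ₊ : H-ℚ → Set
InHℚ₊ (h₁ Data.Product., h₂) = (0ℚ < det h₁) × (0ℚ < h₂)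

IntegralAt : ℕ → ℚ → Set
IntegralAt ℓ q = ¬ (ℓ ∣ ↧ₙ q)

UnitAt : ℕ → ℚ → Set
UnitAt ℓ q = IntegralAt ℓ q × Σ ℚ (λ r → IntegralAt ℓ r × (q * r ≡ 1ℚ))

DivAt : ℕ → ℕ → ℚ → Set
DivAt ℓ n x = Σ ℚ (λ r → IntegralAt ℓ r × (x ≡ (+ (ℓ ^ n) / 1) * r))

CongAt : ℕ → ℕ → ℚ → ℚ → Set
CongAt ℓ n x y = DivAt ℓ n (x - y)

InGL₂At : ℕ → Mat2 → Set
InGL₂At ℓ m =
  IntegralAt ℓ (a m) × IntegralAt ℓ (b m) × IntegralAt ℓ (c m) × IntegralAt ℓ (d m)
  × UnitAt ℓ (det m)

InHℤAt : ℕ → H-ℚ → Set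
InHℤAt ℓ (h₁ Data.Product., h₂) = InGL₂At ℓ h₁ × UnitAt ℓ h₂

InU◇ : ℕ → ℕ → H-ℚ → Set
InU◇ p n (h₁ Data.Product., h₂) =
  InHℤAt p (h₁ Data.Product., h₂)
  × CongAt p n (b h₁) 0ℚ × CongAt p n (c h₁) 0ℚ × CongAt p n (d h₁) 1ℚ

InU : ℕ → ℕ → H-ℚ → Set
InU p n (h₁ Data.Product., h₂) =
  InHℤAt p (h₁ Data.Product., h₂)
  × CongAt p n (a h₁) 1ℚ × CongAt p n (b h₁) 0ℚ
  × CongAt p n (c h₁) 0ℚ × CongAt p n (d h₁) 1ℚ
  × CongAt p n h₂ 1ℚ

-- A positive rational which is an ℓ-adic unit for every prime ℓ is 1, so the hypotheses
-- force det h₁ = 1 and h₂ = 1.  Given b ≡ 0 and d ≡ 1 mod pⁿ, the relation ad − bc = 1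
-- then yields a − 1 = c·b − a·(d − 1) ≡ 0 mod pⁿ.
module Submission where

open import Defs
open import Data.Nat using (ℕ; _≤_)
open import Data.Nat.Primality using (Prime)
open import Relation.Binary.PropositionalEquality using (_≢_)

open import Data.Nat as ℕ using (zero; suc; nonTrivial⇒≢1)
import Data.Nat.Properties as ℕ
open import Data.Nat.Divisibility using (_∣_; ∣-trans; ∣1⇒≡1; m∣m*n; divides)
open import Data.Nat.Coprimality as Coprime using (coprime?; coprime-divisor)
open import Data.Nat.Primality using (euclidsLemma; prime⇒nonTrivial; prime[2])
open import Data.Nat.Primality.Factorisation using (factorise)
open import Data.Integer as ℤ using (+_; +[1+_]; -[1+_])
import Data.Integer.Properties as ℤ
open import Data.Rational as ℚ using (ℚ; mkℚ; 0ℚ; 1ℚ; ↧ₙ_; _+_; _*_; _-_; -_)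
import Data.Rational.Properties as ℚ
import Data.Rational.Unnormalised as ℚᵘ
open import Data.List using ([]; _∷_)
open import Data.Nat.ListAction using (product)
open import Data.List.Relation.Unary.All using (_∷_)
open import Data.Product using (_,_; proj₁; proj₂)
open import Data.Sum using (inj₁; inj₂)
open import Data.Empty using (⊥-elim)
open import Data.Maybe using (nothing)
open import Relation.Binary.PropositionalEquality using (_≡_; refl; sym; trans; cong; cong₂; subst; module ≡-Reasoning)
open import Relation.Nullary using (yes; no)
open import Relation.Nullary.Decidable using (recompute)
open import Algebra.Bundles using (CommutativeMonoid)
open import Algebra.Properties.CommutativeSemigroup (CommutativeMonoid.commutativeSemigroup ℚ.*-1-commutativeMonoid) using (x∙yz≈y∙xz)
open import Tactic.RingSolver using (solve-∀)
open import Tactic.RingSolver.Core.AlmostCommutativeRing using (AlmostCommutativeRing; fromCommutativeRing)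

prime⇒≢1 : ∀ {ℓ} → Prime ℓ → ℓ ≢ 1
prime⇒≢1 pr = nonTrivial⇒≢1 {{prime⇒nonTrivial pr}}

↧ₙ-∣-↧ₙᵘ : ∀ x {y} → ℚ.toℚᵘ x ℚᵘ.≃ y → ↧ₙ x ∣ ℚᵘ.↧ₙ y
↧ₙ-∣-↧ₙᵘ (mkℚ n d-1 coprime) {ℚᵘ.mkℚᵘ m e-1} (ℚᵘ.*≡* eq) =
  coprime-divisor (Coprime.sym (recompute (coprime? _ _) coprime)) (divides ℤ.∣ m ∣ ∣n∣e≡∣m∣d)
  where
  ∣n∣e≡∣m∣d : ℤ.∣ n ∣ ℕ.* suc e-1 ≡ ℤ.∣ m ∣ ℕ.* suc d-1
  ∣n∣e≡∣m∣d = trans (sym (ℤ.abs-* n (+ suc e-1))) (trans (cong ℤ.∣_∣ eq) (ℤ.abs-* m (+ suc d-1)))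

↧ₙ-neg : ∀ x → ↧ₙ (- x) ≡ ↧ₙ x
↧ₙ-neg (mkℚ (+ zero)   _ _) = refl
↧ₙ-neg (mkℚ +[1+ _ ]   _ _) = refl
↧ₙ-neg (mkℚ -[1+ _ ]   _ _) = refl

module _ {ℓ : ℕ} (ℓ-prime : Prime ℓ) where

  integralAt-0 : IntegralAt ℓ 0ℚ
  integralAt-0 ℓ∣1 = prime⇒≢1 ℓ-prime (∣1⇒≡1 ℓ∣1)

  integralAt-neg : ∀ x → IntegralAt ℓ x → IntegralAt ℓ (- x)
  integralAt-neg x x-int ℓ∣den = x-int (subst (ℓ ∣_) (↧ₙ-neg x) ℓ∣den)

  integralAt-∣ : ∀ x y z → ↧ₙ z ∣ ↧ₙ x ℕ.* ↧ₙ y →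
                 IntegralAt ℓ x → IntegralAt ℓ y → IntegralAt ℓ z
  integralAt-∣ x y _ z∣xy x-int y-int ℓ∣z with euclidsLemma (↧ₙ x) (↧ₙ y) ℓ-prime (∣-trans ℓ∣z z∣xy)
  ... | inj₁ ℓ∣x = x-int ℓ∣x
  ... | inj₂ ℓ∣y = y-int ℓ∣y

  integralAt-+ : ∀ x y → IntegralAt ℓ x → IntegralAt ℓ y → IntegralAt ℓ (x + y)
  integralAt-+ x@record{} y@record{} = integralAt-∣ x y (x + y) (↧ₙ-∣-↧ₙᵘ (x + y) (ℚ.toℚᵘ-homo-+ x y))

  integralAt-* : ∀ x y → IntegralAt ℓ x → IntegralAt ℓ y → IntegralAt ℓ (x * y)
  integralAt-* x@record{} y@record{} = integralAt-∣ x y (x * y) (↧ₙ-∣-↧ₙᵘ (x * y) (ℚ.toℚᵘ-homo-* x y))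

integralEverywhere⇒↧ₙ≡1 : ∀ x → (∀ ℓ → Prime ℓ → IntegralAt ℓ x) → ↧ₙ x ≡ 1
integralEverywhere⇒↧ₙ≡1 x@(mkℚ _ _ _) x-int with factorise (↧ₙ x)
... | record { factors = [] ; isFactorisation = ↧ₙx≡1 } = ↧ₙx≡1
... | record { factors = ℓ ∷ ℓs ; isFactorisation = ↧ₙx≡ℓ*ℓs ; factorsPrime = ℓ-prime ∷ _ } =
  ⊥-elim (x-int ℓ ℓ-prime (subst (ℓ ∣_) (sym ↧ₙx≡ℓ*ℓs) (m∣m*n (product ℓs))))

*-inverse-unique : ∀ q r s → q * r ≡ 1ℚ → q * s ≡ 1ℚ → r ≡ s
*-inverse-unique q r s qr≡1 qs≡1 = begin
  r             ≡⟨ ℚ.*-identityʳ r ⟨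
  r * 1ℚ        ≡⟨ cong (r *_) qs≡1 ⟨
  r * (q * s)   ≡⟨ ℚ.*-assoc r q s ⟨
  (r * q) * s   ≡⟨ cong (_* s) (ℚ.*-comm r q) ⟩
  (q * r) * s   ≡⟨ cong (_* s) qr≡1 ⟩
  1ℚ * s        ≡⟨ ℚ.*-identityˡ s ⟩
  s             ∎
  where open ≡-Reasoning

positiveInteger-unit⇒≡1 : ∀ q r → ↧ₙ q ≡ 1 → ↧ₙ r ≡ 1 → 0ℚ ℚ.< q → q * r ≡ 1ℚ → q ≡ 1ℚ
positiveInteger-unit⇒≡1 (mkℚ (+ zero) zero _) _ _ _ (ℚ.*<* (ℤ.+<+ ())) _
positiveInteger-unit⇒≡1 (mkℚ -[1+ _ ] zero _) _ _ _ (ℚ.*<* ()) _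
positiveInteger-unit⇒≡1 q@(mkℚ +[1+ k ] zero _) r@(mkℚ m zero _) _ _ _ qr≡1
  with ℕ.m*n≡1⇒m≡1 (suc k) ℤ.∣ m ∣ ∣q∣*∣r∣≡1
  where
  ∣q∣*∣r∣≡1 : suc k ℕ.* ℤ.∣ m ∣ ≡ 1
  ∣q∣*∣r∣≡1 with subst (λ x → ℚ.toℚᵘ x ℚᵘ.≃ ℚ.toℚᵘ q ℚᵘ.* ℚ.toℚᵘ r) qr≡1 (ℚ.toℚᵘ-homo-* q r)
  ... | ℚᵘ.*≡* 1≡qr*1 = begin
    suc k ℕ.* ℤ.∣ m ∣               ≡⟨ ℤ.abs-* +[1+ k ] m ⟨
    ℤ.∣ +[1+ k ] ℤ.* m ∣            ≡⟨ cong ℤ.∣_∣ (ℤ.*-identityʳ (+[1+ k ] ℤ.* m)) ⟨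
    ℤ.∣ +[1+ k ] ℤ.* m ℤ.* + 1 ∣    ≡⟨ cong ℤ.∣_∣ 1≡qr*1 ⟨
    1                               ∎
    where open ≡-Reasoning
... | refl = refl

-- Every ℓ supplies an ℓ-integral inverse of q; by uniqueness they all equal the inverse r at 2.
positive-unitEverywhere⇒≡1 : ∀ q → 0ℚ ℚ.< q → (∀ ℓ → Prime ℓ → UnitAt ℓ q) → q ≡ 1ℚ
positive-unitEverywhere⇒≡1 q q>0 q-unit =
  positiveInteger-unit⇒≡1 q r (integralEverywhere⇒↧ₙ≡1 q (λ ℓ ℓ-prime → proj₁ (q-unit ℓ ℓ-prime)))
    (integralEverywhere⇒↧ₙ≡1 r r-integral) q>0 qr≡1
  where
  r : ℚ
  r = proj₁ (proj₂ (q-unit 2 prime[2]))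
  qr≡1 : q * r ≡ 1ℚ
  qr≡1 = proj₂ (proj₂ (proj₂ (q-unit 2 prime[2])))
  r-integral : ∀ ℓ → Prime ℓ → IntegralAt ℓ r
  r-integral ℓ ℓ-prime with q-unit ℓ ℓ-prime
  ... | _ , s , s-int , qs≡1 = subst (IntegralAt ℓ) (*-inverse-unique q s r qs≡1 qr≡1) s-int

ℚ-ring : AlmostCommutativeRing _ _
ℚ-ring = fromCommutativeRing ℚ.+-*-commutativeRing (λ _ → nothing)

module _ {ℓ : ℕ} (ℓ-prime : Prime ℓ) (n : ℕ) where

  private
    ℓⁿ : ℚ
    ℓⁿ = + (ℓ ℕ.^ n) ℚ./ 1

  divAt-0 : DivAt ℓ n 0ℚ
  divAt-0 = 0ℚ , integralAt-0 ℓ-prime , sym (ℚ.*-zeroʳ ℓⁿ)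

  divAt-+ : ∀ {x y} → DivAt ℓ n x → DivAt ℓ n y → DivAt ℓ n (x + y)
  divAt-+ {x} {y} (r , r-int , x≡ℓⁿr) (s , s-int , y≡ℓⁿs) =
    r + s , integralAt-+ ℓ-prime r s r-int s-int , (begin
      x + y               ≡⟨ cong₂ _+_ x≡ℓⁿr y≡ℓⁿs ⟩
      ℓⁿ * r + ℓⁿ * s     ≡⟨ ℚ.*-distribˡ-+ ℓⁿ r s ⟨
      ℓⁿ * (r + s)        ∎)
    where open ≡-Reasoning

  divAt-*ˡ : ∀ y {x} → IntegralAt ℓ y → DivAt ℓ n x → DivAt ℓ n (y * x)
  divAt-*ˡ y y-int (r , r-int , x≡ℓⁿr) =
    y * r , integralAt-* ℓ-prime y r y-int r-int ,
    trans (cong (y *_) x≡ℓⁿr) (x∙yz≈y∙xz y ℓⁿ r)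

  congAt-refl : ∀ x → CongAt ℓ n x x
  congAt-refl x = subst (DivAt ℓ n) (sym (ℚ.+-inverseʳ x)) divAt-0

  det≡1⇒congAt-a : (m : Mat2) → det m ≡ 1ℚ → IntegralAt ℓ (a m) → IntegralAt ℓ (c m) →
                   CongAt ℓ n (b m) 0ℚ → CongAt ℓ n (d m) 1ℚ → CongAt ℓ n (a m) 1ℚ
  det≡1⇒congAt-a (mat a b c d) det≡1 a-int c-int b≡0 d≡1 =
    subst (DivAt ℓ n) a-1≡cb-a[d-1]
      (divAt-+ (divAt-*ˡ c c-int (subst (DivAt ℓ n) (ℚ.+-identityʳ b) b≡0))
               (divAt-*ˡ (- a) (integralAt-neg ℓ-prime a a-int) d≡1))
    where
    a-1≡cb-a[d-1] : c * b + (- a) * (d - 1ℚ) ≡ a - 1ℚ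
    a-1≡cb-a[d-1] = trans (sym (expand a b c d)) (cong (λ δ → a - δ) det≡1)
      where
      expand : ∀ a b c d → a - (a * d - b * c) ≡ c * b + (- a) * (d - 1ℚ)
      expand = solve-∀ ℚ-ring

lemma3p7 : (p : ℕ) → Prime p → (n : ℕ) → 1 ≤ n → (h : H-ℚ) → InHℚ₊ h
    → ((ℓ : ℕ) → Prime ℓ → ℓ ≢ p → InHℤAt ℓ h) → InU◇ p n h → InU p n h
lemma3p7 p p-prime n _ h@(h₁ , h₂) (det>0 , h₂>0) integral-away (hₚ , b≡0 , c≡0 , d≡1) =
  hₚ , det≡1⇒congAt-a p-prime n h₁ det≡1 a-int c-int b≡0 d≡1 , b≡0 , c≡0 , d≡1 ,
  subst (λ x → CongAt p n x 1ℚ) (sym h₂≡1) (congAt-refl p-prime n 1ℚ)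
  where
  a-int : IntegralAt p (a h₁)
  a-int = proj₁ (proj₁ hₚ)
  c-int : IntegralAt p (c h₁)
  c-int = proj₁ (proj₂ (proj₂ (proj₁ hₚ)))

  integral : ∀ ℓ → Prime ℓ → InHℤAt ℓ h
  integral ℓ ℓ-prime with ℓ ℕ.≟ p
  ... | yes refl = hₚ
  ... | no ℓ≢p   = integral-away ℓ ℓ-prime ℓ≢p

  det-unit : ∀ ℓ → Prime ℓ → UnitAt ℓ (det h₁)
  det-unit ℓ ℓ-prime with integral ℓ ℓ-prime
  ... | (_ , _ , _ , _ , u) , _ = u

  det≡1 : det h₁ ≡ 1ℚ
  det≡1 = positive-unitEverywhere⇒≡1 (det h₁) det>0 det-unit

  h₂≡1 : h₂ ≡ 1ℚ
  h₂≡1 = positive-unitEverywhere⇒≡1 h₂ h₂>0 (λ ℓ ℓ-prime → proj₂ (integral ℓ ℓ-prime))
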